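{- Let $d,k,\gamma$ be nonnegative integers, and let $\mathcal{B}_{d,\gamma}$ denote the set of nonnegative linear combinations of polynomials of the form $x^i(x+1)^{d-i}+x^j(x+1)^{d-j}$ with $0\le i,j\le d$ and $i+j\ge\gamma$. Then $\phi_k(\mathcal{B}_{d,\gamma})\subseteq\mathcal{B}_{d,\gamma}$.
   Context: $\phi_k=T_k/k!$, where $T_k:\mathbb{R}[x]\to\mathbb{R}[x]$ is the linear operator $T_k(f)(x)=\sum_{i=0}^k(-1)^{k-i}\binom{k}{i}f((i+1)x)$; equivalently $T_k(x^m)=k!\,S(m+1,k+1)x^m$, with $S$ the Stirling numbers of the second kind.
   Formalization: Polynomials are taken over ℚ rather than ℝ, and the nonnegative linear combinations defining $\mathcal{B}_{d,\gamma}$ have rational coefficients. -}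

module Defs where

open import Data.Nat as ℕ using (ℕ; zero; suc; _∸_; _≤_; _!)
open import Data.Nat.Properties using (_!≢0)
open import Data.Nat.Combinatorics using (_C_)
open import Data.Integer using (+_)
open import Data.Rational using (ℚ; 0ℚ; 1ℚ; _+_; _*_; -_; _/_) renaming (_≤_ to _≤ℚ_)
open import Data.List using (List; []; _∷_)
open import Data.List.Relation.Unary.All using (All)
open import Data.Product using (Σ; _×_; _,_)
open import Relation.Binary.PropositionalEquality using (_≡_)

-- A real polynomial is represented by its coefficient sequence (coefficient
-- of x^m at position m); coefficients are taken in ℚ.
Poly : Set
Poly = ℕ → ℚ

ℕ→ℚ : ℕ → ℚ
ℕ→ℚ n = + n / 1

sumTo : ℕ → (ℕ → ℚ) → ℚ
sumTo zero    g = g 0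
sumTo (suc n) g = sumTo n g + g (suc n)

negPow : ℕ → ℚ → ℚ
negPow zero    q = q
negPow (suc n) q = - negPow n q

_⊕_ : Poly → Poly → Poly
(f ⊕ g) m = f m + g m

_⊗_ : Poly → Poly → Poly
(f ⊗ g) m = sumTo m (λ i → f i * g (m ∸ i))

scale : ℚ → Poly → Poly
scale c f m = c * f m

one : Poly
one zero    = 1ℚ
one (suc _) = 0ℚ

X : Poly
X 1 = 1ℚ
X _ = 0ℚ

X+1 : Poly
X+1 zero = 1ℚ
X+1 1    = 1ℚ
X+1 _    = 0ℚ

_^ᵖ_ : Poly → ℕ → Poly
f ^ᵖ zero  = one
f ^ᵖ suc n = f ⊗ (f ^ᵖ n)

dilate : ℕ → Poly → Poly
dilate c f m = ℕ→ℚ (c ℕ.^ m) * f m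

T : ℕ → Poly → Poly
T k f m = sumTo k (λ i → negPow (k ∸ i) (ℕ→ℚ (k C i) * dilate (suc i) f m))

φ : ℕ → Poly → Poly
φ k f = scale (_/_ (+ 1) (k !) {{k !≢0}}) (T k f)

gen : ℕ → ℕ → Poly
gen d i = (X ^ᵖ i) ⊗ (X+1 ^ᵖ (d ∸ i))

Admissible : ℕ → ℕ → ℕ × ℕ × ℚ → Set
Admissible d γ (i , j , c) = (i ≤ d) × (j ≤ d) × (γ ≤ i ℕ.+ j) × (0ℚ ≤ℚ c)

combo : ℕ → List (ℕ × ℕ × ℚ) → Poly
combo d []                  = λ _ → 0ℚ
combo d ((i , j , c) ∷ ts) = scale c (gen d i ⊕ gen d j) ⊕ combo d ts

InB : ℕ → ℕ → Poly → Set
InB d γ f = Σ (List (ℕ × ℕ × ℚ)) λ ts → All (Admissible d γ) ts × (∀ m → f m ≡ combo d ts m)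

module Submission where

-- φ_k is diagonal: it multiplies x^m by S(m+1,k+1) = Δ^k[(l+1)^m](0) / k!. Since
-- (l+1)x + 1 = (x+1) + l x, the dilated generator ((l+1)x)^a ((l+1)x+1)^(d-a) equals
-- Σ_r C(d-a,r) (l+1)^a l^r · x^(a+r) (x+1)^(d-a-r); applying Δ^k / k! in l shows that φ_k sends
-- x^a (x+1)^(d-a) to Σ_r w(a,r) x^(a+r) (x+1)^(d-a-r), where w(a,r) ≥ 0 because every forward
-- difference of (1+l)^a l^r is nonnegative (Leibniz rule). Comparing leading coefficients,
-- Σ_r w(a,r) = S(d+1,k+1) =: M for every a. If M > 0, then φ_k of x^i (x+1)^(d-i) + x^j (x+1)^(d-j)
-- is Σ_{r,r'} w(i,r) w(j,r') / M · (x^(i+r) (x+1)^(d-i-r) + x^(j+r') (x+1)^(d-j-r')), and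
-- (i+r) + (j+r') ≥ i + j ≥ γ; if M = 0, all weights vanish and the image is 0.

open import Defs
open import Data.Nat as ℕ using (ℕ; zero; suc; _∸_; _!; z≤n; s≤s)
import Data.Nat.Properties as ℕ
open import Data.Nat.Coprimality using (1-coprimeTo) renaming (sym to coprime-sym)
import Data.Integer as ℤ
import Data.Integer.Properties as ℤ
open import Data.Rational as ℚ using (ℚ; mkℚ; 0ℚ; 1ℚ; _+_; _*_; -_; _-_; 1/_; _≤_)
open import Data.Rational.Properties
open import Data.Nat.Combinatorics
  using (_C_; nCn≡1; nCk+nC[k+1]≡[n+1]C[k+1]; k>n⇒nCk≡0; nCk≡n!/k![n-k]!; k![n∸k]!∣n!)
open import Data.Nat.DivMod using (m/n*n≡m)
open import Data.List using ([]; _∷_; _++_)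
open import Data.List.Relation.Unary.All using (All; []; _∷_)
open import Data.List.Relation.Unary.All.Properties using (++⁺)
open import Data.Product using (_,_)
open import Data.Sum using (inj₁; inj₂)
open import Function using (_∘_)
open import Relation.Nullary using (contradiction)
open import Relation.Nullary.Decidable using (dec⇒maybe; yes; no)
open import Relation.Binary.Definitions using (tri<; tri≈; tri>)
open import Relation.Binary.PropositionalEquality
import Tactic.RingSolver.Core.AlmostCommutativeRing as ACR
open import Tactic.RingSolver using (solve-∀)
open import Data.Nat.Tactic.RingSolver using () renaming (solve-∀ to solve-∀ℕ)

-- The zero test lets the solver normalise the constants 0ℚ and 1ℚ.
ℚ-ring : ACR.AlmostCommutativeRing _ _
ℚ-ring = ACR.fromCommutativeRing +-*-commutativeRing (λ p → dec⇒maybe (0ℚ ≟ p))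

x+[y+z]≡y+[x+z] : ∀ x y z → x + (y + z) ≡ y + (x + z)
x+[y+z]≡y+[x+z] = solve-∀ ℚ-ring

*-pair-distrib : ∀ μ c x y → μ * (c * (x + y)) ≡ c * (μ * x + μ * y)
*-pair-distrib = solve-∀ ℚ-ring

ℕ→ℚ≡mkℚ : ∀ n → ℕ→ℚ n ≡ mkℚ (ℤ.+ n) 0 (coprime-sym (1-coprimeTo n))
ℕ→ℚ≡mkℚ n = normalize-coprime _

ℕ→ℚ-+ : ∀ a b → ℕ→ℚ (a ℕ.+ b) ≡ ℕ→ℚ a + ℕ→ℚ b
ℕ→ℚ-+ a b rewrite ℕ→ℚ≡mkℚ a | ℕ→ℚ≡mkℚ b =
  cong (ℚ._/ 1) (cong₂ ℤ._+_ (sym (ℤ.*-identityʳ (ℤ.+ a))) (sym (ℤ.*-identityʳ (ℤ.+ b))))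

ℕ→ℚ-* : ∀ a b → ℕ→ℚ (a ℕ.* b) ≡ ℕ→ℚ a * ℕ→ℚ b
ℕ→ℚ-* a b rewrite ℕ→ℚ≡mkℚ a | ℕ→ℚ≡mkℚ b = cong (ℚ._/ 1) (ℤ.pos-* a b)

ℕ→ℚ-nonNeg : ∀ n → 0ℚ ≤ ℕ→ℚ n
ℕ→ℚ-nonNeg n rewrite ℕ→ℚ≡mkℚ n = nonNegative⁻¹ _

*-nonNeg : ∀ {p q} → 0ℚ ≤ p → 0ℚ ≤ q → 0ℚ ≤ p * q
*-nonNeg {p} {q} 0≤p 0≤q =
  nonNegative⁻¹ _ {{nonNeg*nonNeg⇒nonNeg p {{ℚ.nonNegative 0≤p}} q {{ℚ.nonNegative 0≤q}}}}

p≤p+q : ∀ p {q} → 0ℚ ≤ q → p ≤ p + q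
p≤p+q p 0≤q = ≤-trans (≤-reflexive (sym (+-identityʳ p))) (+-monoʳ-≤ p 0≤q)

p≤q+p : ∀ p {q} → 0ℚ ≤ q → p ≤ q + p
p≤q+p p {q} 0≤q = subst (p ≤_) (+-comm p q) (p≤p+q p 0≤q)

sumTo-cong : ∀ n {f g : ℕ → ℚ} → (∀ i → i ℕ.≤ n → f i ≡ g i) → sumTo n f ≡ sumTo n g
sumTo-cong zero    f≡g = f≡g 0 z≤n
sumTo-cong (suc n) f≡g =
  cong₂ _+_ (sumTo-cong n (λ i i≤n → f≡g i (ℕ.m≤n⇒m≤1+n i≤n))) (f≡g (suc n) ℕ.≤-refl)

sumTo-+ : ∀ n (f g : ℕ → ℚ) → sumTo n (λ i → f i + g i) ≡ sumTo n f + sumTo n g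
sumTo-+ zero    f g = refl
sumTo-+ (suc n) f g =
  trans (cong (_+ (f (suc n) + g (suc n))) (sumTo-+ n f g))
        (interchange (sumTo n f) (sumTo n g) (f (suc n)) (g (suc n)))
  where
  interchange : ∀ a b c d → (a + b) + (c + d) ≡ (a + c) + (b + d)
  interchange = solve-∀ ℚ-ring

sumTo-*ˡ : ∀ n c (f : ℕ → ℚ) → sumTo n (λ i → c * f i) ≡ c * sumTo n f
sumTo-*ˡ zero    c f = refl
sumTo-*ˡ (suc n) c f =
  trans (cong (_+ c * f (suc n)) (sumTo-*ˡ n c f)) (sym (*-distribˡ-+ c (sumTo n f) (f (suc n))))

sumTo-*ʳ : ∀ n c (f : ℕ → ℚ) → sumTo n (λ i → f i * c) ≡ sumTo n f * c
sumTo-*ʳ n c f =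
  trans (sumTo-cong n (λ i _ → *-comm (f i) c)) (trans (sumTo-*ˡ n c f) (*-comm c (sumTo n f)))

sumTo-neg : ∀ n (f : ℕ → ℚ) → sumTo n (λ i → - f i) ≡ - sumTo n f
sumTo-neg zero    f = refl
sumTo-neg (suc n) f =
  trans (cong (_+ - f (suc n)) (sumTo-neg n f)) (sym (neg-distrib-+ (sumTo n f) (f (suc n))))

sumTo-head-tail : ∀ n (f : ℕ → ℚ) → sumTo (suc n) f ≡ f 0 + sumTo n (f ∘ suc)
sumTo-head-tail zero    f = refl
sumTo-head-tail (suc n) f =
  trans (cong (_+ f (suc (suc n))) (sumTo-head-tail n f)) (+-assoc (f 0) _ _)

sumTo-zeros : ∀ n {f : ℕ → ℚ} → (∀ i → i ℕ.≤ n → f i ≡ 0ℚ) → sumTo n f ≡ 0ℚ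
sumTo-zeros zero    f≡0 = f≡0 0 z≤n
sumTo-zeros (suc n) f≡0 =
  cong₂ _+_ (sumTo-zeros n (λ i i≤n → f≡0 i (ℕ.m≤n⇒m≤1+n i≤n))) (f≡0 (suc n) ℕ.≤-refl)

sumTo-head : ∀ n {f : ℕ → ℚ} → (∀ i → f (suc i) ≡ 0ℚ) → sumTo n f ≡ f 0
sumTo-head zero    _       = refl
sumTo-head (suc n) {f} tail≡0 = begin
  sumTo (suc n) f          ≡⟨ sumTo-head-tail n f ⟩
  f 0 + sumTo n (f ∘ suc)  ≡⟨ cong (f 0 +_) (sumTo-zeros n (λ i _ → tail≡0 i)) ⟩
  f 0 + 0ℚ                 ≡⟨ +-identityʳ (f 0) ⟩
  f 0                      ∎
  where open ≡-Reasoning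

sumTo-nonNeg : ∀ n {f : ℕ → ℚ} → (∀ i → 0ℚ ≤ f i) → 0ℚ ≤ sumTo n f
sumTo-nonNeg zero    0≤f = 0≤f 0
sumTo-nonNeg (suc n) 0≤f = +-mono-≤ (sumTo-nonNeg n 0≤f) (0≤f (suc n))

term≤sumTo : ∀ n {f : ℕ → ℚ} → (∀ i → 0ℚ ≤ f i) → ∀ {i} → i ℕ.≤ n → f i ≤ sumTo n f
term≤sumTo zero    0≤f z≤n = ≤-refl
term≤sumTo (suc n) {f} 0≤f i≤1+n with ℕ.m≤n⇒m<n∨m≡n i≤1+n
... | inj₁ (s≤s i≤n) = ≤-trans (term≤sumTo n 0≤f i≤n) (p≤p+q (sumTo n f) (0≤f (suc n)))
... | inj₂ refl      = p≤q+p (f (suc n)) (sumTo-nonNeg n 0≤f)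

nonNeg-sumTo≡0 : ∀ n {f : ℕ → ℚ} → (∀ i → 0ℚ ≤ f i) → sumTo n f ≡ 0ℚ →
                 ∀ {i} → i ℕ.≤ n → f i ≡ 0ℚ
nonNeg-sumTo≡0 n 0≤f sum≡0 i≤n = ≤-antisym (subst (_ ≤_) sum≡0 (term≤sumTo n 0≤f i≤n)) (0≤f _)

Δ : ℕ → (ℕ → ℚ) → ℚ
Δ zero    g = g 0
Δ (suc k) g = Δ k (g ∘ suc) - Δ k g

Δ-cong : ∀ k {f g : ℕ → ℚ} → (∀ l → f l ≡ g l) → Δ k f ≡ Δ k g
Δ-cong zero    f≡g = f≡g 0
Δ-cong (suc k) f≡g = cong₂ _-_ (Δ-cong k (f≡g ∘ suc)) (Δ-cong k f≡g)

Δ-*ˡ : ∀ k c (f : ℕ → ℚ) → Δ k (λ l → c * f l) ≡ c * Δ k f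
Δ-*ˡ zero    c f = refl
Δ-*ˡ (suc k) c f =
  trans (cong₂ _-_ (Δ-*ˡ k c (f ∘ suc)) (Δ-*ˡ k c f)) (factor c (Δ k (f ∘ suc)) (Δ k f))
  where
  factor : ∀ c a b → c * a - c * b ≡ c * (a - b)
  factor = solve-∀ ℚ-ring

Δ-*ʳ : ∀ k c (f : ℕ → ℚ) → Δ k (λ l → f l * c) ≡ Δ k f * c
Δ-*ʳ k c f = trans (Δ-cong k (λ l → *-comm (f l) c)) (trans (Δ-*ˡ k c f) (*-comm c (Δ k f)))

Δ-sumTo : ∀ k n (F : ℕ → ℕ → ℚ) →
          Δ k (λ l → sumTo n (F l)) ≡ sumTo n (λ r → Δ k (λ l → F l r))
Δ-sumTo zero    n F = refl
Δ-sumTo (suc k) n F = begin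
  Δ k (λ l → sumTo n (F (suc l))) - Δ k (λ l → sumTo n (F l))
    ≡⟨ cong₂ _-_ (Δ-sumTo k n (F ∘ suc)) (Δ-sumTo k n F) ⟩
  sumTo n (λ r → Δ k (λ l → F (suc l) r)) - sumTo n (λ r → Δ k (λ l → F l r))
    ≡⟨ cong (sumTo n (λ r → Δ k (λ l → F (suc l) r)) +_) (sym (sumTo-neg n _)) ⟩
  sumTo n (λ r → Δ k (λ l → F (suc l) r)) + sumTo n (λ r → - Δ k (λ l → F l r))
    ≡⟨ sym (sumTo-+ n _ _) ⟩
  sumTo n (λ r → Δ (suc k) (λ l → F l r)) ∎
  where open ≡-Reasoning

Δ-leibniz : ∀ k c (g : ℕ → ℚ) →
            Δ (suc k) (λ l → (c + ℕ→ℚ l) * g l) ≡ c * Δ (suc k) g + ℕ→ℚ (suc k) * Δ k (g ∘ suc)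
Δ-leibniz zero    c g = base c (g 1) (g 0)
  where
  base : ∀ c a b → (c + 1ℚ) * a - (c + 0ℚ) * b ≡ c * (a - b) + 1ℚ * a
  base = solve-∀ ℚ-ring
Δ-leibniz (suc k) c g = begin
  Δ (suc k) (λ l → (c + ℕ→ℚ (suc l)) * g (suc l)) - Δ (suc k) (λ l → (c + ℕ→ℚ l) * g l)
    ≡⟨ cong (_- Δ (suc k) (λ l → (c + ℕ→ℚ l) * g l)) (Δ-cong (suc k) shift) ⟩
  Δ (suc k) (λ l → ((c + 1ℚ) + ℕ→ℚ l) * g (suc l)) - Δ (suc k) (λ l → (c + ℕ→ℚ l) * g l)
    ≡⟨ cong₂ _-_ (Δ-leibniz k (c + 1ℚ) (g ∘ suc)) (Δ-leibniz k c g) ⟩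
  ((c + 1ℚ) * (Q - S) + K * Q) - (c * R + K * S)
    ≡⟨ regroup c Q S R K ⟩
  c * ((Q - S) - R) + (1ℚ + K) * (Q - S)
    ≡⟨ cong (λ z → c * ((Q - S) - R) + z * (Q - S)) (sym (ℕ→ℚ-+ 1 (suc k))) ⟩
  c * ((Q - S) - R) + ℕ→ℚ (suc (suc k)) * (Q - S) ∎
  where
  open ≡-Reasoning
  Q = Δ k (g ∘ suc ∘ suc)
  S = Δ k (g ∘ suc)
  R = Δ (suc k) g
  K = ℕ→ℚ (suc k)
  shift : ∀ l → (c + ℕ→ℚ (suc l)) * g (suc l) ≡ ((c + 1ℚ) + ℕ→ℚ l) * g (suc l)
  shift l = cong (_* g (suc l)) (trans (cong (c +_) (ℕ→ℚ-+ 1 l)) (sym (+-assoc c 1ℚ (ℕ→ℚ l))))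
  regroup : ∀ c Q S R K → ((c + 1ℚ) * (Q - S) + K * Q) - (c * R + K * S)
                          ≡ c * ((Q - S) - R) + (1ℚ + K) * (Q - S)
  regroup = solve-∀ ℚ-ring

negPow-+ : ∀ n p q → negPow n (p + q) ≡ negPow n p + negPow n q
negPow-+ zero    p q = refl
negPow-+ (suc n) p q = trans (cong -_ (negPow-+ n p q)) (neg-distrib-+ (negPow n p) (negPow n q))

alternatingSum : ℕ → (ℕ → ℚ) → ℚ
alternatingSum k g = sumTo k (λ i → negPow (k ∸ i) (ℕ→ℚ (k C i) * g i))

negPow-pascal : ∀ n k i (x : ℚ) → negPow n (ℕ→ℚ (suc k C suc i) * x)
                                   ≡ negPow n (ℕ→ℚ (k C i) * x) + negPow n (ℕ→ℚ (k C suc i) * x)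
negPow-pascal n k i x = begin
  negPow n (ℕ→ℚ (suc k C suc i) * x)
    ≡⟨ cong (λ c → negPow n (ℕ→ℚ c * x)) (sym (nCk+nC[k+1]≡[n+1]C[k+1] k i)) ⟩
  negPow n (ℕ→ℚ (k C i ℕ.+ k C suc i) * x)
    ≡⟨ cong (λ p → negPow n (p * x)) (ℕ→ℚ-+ (k C i) (k C suc i)) ⟩
  negPow n ((ℕ→ℚ (k C i) + ℕ→ℚ (k C suc i)) * x)
    ≡⟨ cong (negPow n) (*-distribʳ-+ x (ℕ→ℚ (k C i)) (ℕ→ℚ (k C suc i))) ⟩
  negPow n (ℕ→ℚ (k C i) * x + ℕ→ℚ (k C suc i) * x)
    ≡⟨ negPow-+ n _ _ ⟩
  negPow n (ℕ→ℚ (k C i) * x) + negPow n (ℕ→ℚ (k C suc i) * x) ∎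
  where open ≡-Reasoning

alternatingSum-sign-shift : ∀ k (g : ℕ → ℚ) →
  negPow (suc k) (g 0) + sumTo k (λ i → negPow (k ∸ i) (ℕ→ℚ (k C suc i) * g (suc i)))
  ≡ - alternatingSum k g
alternatingSum-sign-shift k g = begin
  negPow (suc k) (g 0) + sumTo k (F ∘ suc)
    ≡⟨ cong (λ p → negPow (suc k) p + sumTo k (F ∘ suc)) (sym (*-identityˡ (g 0))) ⟩
  F 0 + sumTo k (F ∘ suc)
    ≡⟨ sym (sumTo-head-tail k F) ⟩
  sumTo k F + negPow (suc k ∸ suc k) (ℕ→ℚ (k C suc k) * g (suc k))
    ≡⟨ cong (λ c → sumTo k F + negPow (k ∸ k) (ℕ→ℚ c * g (suc k))) (k>n⇒nCk≡0 (ℕ.n<1+n k)) ⟩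
  sumTo k F + negPow (k ∸ k) (0ℚ * g (suc k))
    ≡⟨ cong (λ n → sumTo k F + negPow n (0ℚ * g (suc k))) (ℕ.n∸n≡0 k) ⟩
  sumTo k F + 0ℚ * g (suc k)
    ≡⟨ trans (cong (sumTo k F +_) (*-zeroˡ (g (suc k)))) (+-identityʳ (sumTo k F)) ⟩
  sumTo k F
    ≡⟨ sumTo-cong k (λ i i≤k → cong (λ n → negPow n (ℕ→ℚ (k C i) * g i)) (ℕ.+-∸-assoc 1 i≤k)) ⟩
  sumTo k (λ i → - negPow (k ∸ i) (ℕ→ℚ (k C i) * g i))
    ≡⟨ sumTo-neg k _ ⟩
  - alternatingSum k g ∎
  where
  open ≡-Reasoning
  F : ℕ → ℚ
  F i = negPow (suc k ∸ i) (ℕ→ℚ (k C i) * g i)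

alternatingSum≡Δ : ∀ k (g : ℕ → ℚ) → alternatingSum k g ≡ Δ k g
alternatingSum≡Δ zero    g = *-identityˡ (g 0)
alternatingSum≡Δ (suc k) g = begin
  alternatingSum (suc k) g
    ≡⟨ sumTo-head-tail k _ ⟩
  negPow (suc k) (1ℚ * g 0) + sumTo k (λ i → negPow (k ∸ i) (ℕ→ℚ (suc k C suc i) * g (suc i)))
    ≡⟨ cong₂ _+_ (cong (negPow (suc k)) (*-identityˡ (g 0)))
                 (trans (sumTo-cong k (λ i _ → negPow-pascal (k ∸ i) k i (g (suc i)))) (sumTo-+ k _ _)) ⟩
  g₀ + (alternatingSum k (g ∘ suc) + rest)
    ≡⟨ x+[y+z]≡y+[x+z] g₀ (alternatingSum k (g ∘ suc)) rest ⟩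
  alternatingSum k (g ∘ suc) + (g₀ + rest)
    ≡⟨ cong₂ _+_ (alternatingSum≡Δ k (g ∘ suc))
                 (trans (alternatingSum-sign-shift k g) (cong -_ (alternatingSum≡Δ k g))) ⟩
  Δ (suc k) g ∎
  where
  open ≡-Reasoning
  g₀ = negPow (suc k) (g 0)
  rest = sumTo k (λ i → negPow (k ∸ i) (ℕ→ℚ (k C suc i) * g (suc i)))

AbsolutelyMonotone : (ℕ → ℕ) → Set
AbsolutelyMonotone f = ∀ k x → 0ℚ ≤ Δ k (λ l → ℕ→ℚ (f (x ℕ.+ l)))

absMono-cong : ∀ {f g} → (∀ l → f l ≡ g l) → AbsolutelyMonotone f → AbsolutelyMonotone g
absMono-cong f≡g mono k x =
  subst (0ℚ ≤_) (Δ-cong k (λ l → cong ℕ→ℚ (f≡g (x ℕ.+ l)))) (mono k x)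

absMono-const : ∀ c → AbsolutelyMonotone (λ _ → c)
absMono-const c zero    x = ℕ→ℚ-nonNeg c
absMono-const c (suc k) x = ≤-reflexive (sym (+-inverseʳ (Δ k (λ _ → ℕ→ℚ c))))

absMono-linear* : ∀ a {f} → AbsolutelyMonotone f → AbsolutelyMonotone (λ l → (a ℕ.+ l) ℕ.* f l)
absMono-linear* a {f} mono zero    x = ℕ→ℚ-nonNeg ((a ℕ.+ (x ℕ.+ 0)) ℕ.* f (x ℕ.+ 0))
absMono-linear* a {f} mono (suc k) x = subst (0ℚ ≤_) (sym leibniz)
  (+-mono-≤ (*-nonNeg (ℕ→ℚ-nonNeg (a ℕ.+ x)) (mono (suc k) x))
            (*-nonNeg (ℕ→ℚ-nonNeg (suc k)) (mono k (suc x))))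
  where
  g : ℕ → ℚ
  g l = ℕ→ℚ (f (x ℕ.+ l))
  factor : ∀ l → ℕ→ℚ ((a ℕ.+ (x ℕ.+ l)) ℕ.* f (x ℕ.+ l)) ≡ (ℕ→ℚ (a ℕ.+ x) + ℕ→ℚ l) * g l
  factor l = trans (ℕ→ℚ-* (a ℕ.+ (x ℕ.+ l)) _)
    (cong (_* g l) (trans (cong ℕ→ℚ (sym (ℕ.+-assoc a x l))) (ℕ→ℚ-+ (a ℕ.+ x) l)))
  leibniz : Δ (suc k) (λ l → ℕ→ℚ ((a ℕ.+ (x ℕ.+ l)) ℕ.* f (x ℕ.+ l)))
            ≡ ℕ→ℚ (a ℕ.+ x) * Δ (suc k) g + ℕ→ℚ (suc k) * Δ k (λ l → ℕ→ℚ (f (suc x ℕ.+ l)))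
  leibniz = trans (Δ-cong (suc k) factor) (trans (Δ-leibniz k (ℕ→ℚ (a ℕ.+ x)) g)
    (cong (ℕ→ℚ (a ℕ.+ x) * Δ (suc k) g +_)
          (cong (ℕ→ℚ (suc k) *_) (Δ-cong k (λ l → cong (ℕ→ℚ ∘ f) (ℕ.+-suc x l))))))

absMono-monomial : ∀ c i r → AbsolutelyMonotone (λ l → c ℕ.* (suc l ℕ.^ i ℕ.* l ℕ.^ r))
absMono-monomial c zero    zero    = absMono-cong (λ _ → sym (ℕ.*-identityʳ c)) (absMono-const c)
absMono-monomial c i       (suc r) =
  absMono-cong (λ l → sym (move-factor c l (suc l ℕ.^ i) (l ℕ.^ r)))
               (absMono-linear* 0 {λ l → c ℕ.* (suc l ℕ.^ i ℕ.* l ℕ.^ r)} (absMono-monomial c i r))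
  where
  move-factor : ∀ c l p q → c ℕ.* (p ℕ.* (l ℕ.* q)) ≡ (0 ℕ.+ l) ℕ.* (c ℕ.* (p ℕ.* q))
  move-factor = solve-∀ℕ
absMono-monomial c (suc i) zero    =
  absMono-cong (λ l → sym (move-factor c (suc l) (suc l ℕ.^ i)))
               (absMono-linear* 1 {λ l → c ℕ.* (suc l ℕ.^ i ℕ.* 1)} (absMono-monomial c i zero))
  where
  move-factor : ∀ c m p → c ℕ.* ((m ℕ.* p) ℕ.* 1) ≡ m ℕ.* (c ℕ.* (p ℕ.* 1))
  move-factor = solve-∀ℕ

invFactorial : ℕ → ℚ
invFactorial k = (ℤ.+ 1 ℚ./ k !) {{k ℕ.!≢0}}

invFactorial-nonNeg : ∀ k → 0ℚ ≤ invFactorial k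
invFactorial-nonNeg k = nonNegative⁻¹ _ {{normalize-nonNeg 1 (k !) {{k ℕ.!≢0}}}}

eigenvalue : ℕ → ℕ → ℚ
eigenvalue k m = invFactorial k * Δ k (λ l → ℕ→ℚ (suc l ℕ.^ m))

φ-coeff : ∀ k f m → φ k f m ≡ eigenvalue k m * f m
φ-coeff k f m = begin
  invFactorial k * alternatingSum k (λ l → ℕ→ℚ (suc l ℕ.^ m) * f m)
    ≡⟨ cong (invFactorial k *_) (alternatingSum≡Δ k _) ⟩
  invFactorial k * Δ k (λ l → ℕ→ℚ (suc l ℕ.^ m) * f m)
    ≡⟨ cong (invFactorial k *_) (Δ-*ʳ k (f m) _) ⟩
  invFactorial k * (Δ k (λ l → ℕ→ℚ (suc l ℕ.^ m)) * f m)
    ≡⟨ sym (*-assoc (invFactorial k) _ (f m)) ⟩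
  eigenvalue k m * f m ∎
  where open ≡-Reasoning

one⊗ : ∀ g m → (one ⊗ g) m ≡ g m
one⊗ g m = trans (sumTo-head m (λ i → *-zeroˡ (g (m ∸ suc i)))) (*-identityˡ (g m))

X⊗-zero : ∀ f → (X ⊗ f) 0 ≡ 0ℚ
X⊗-zero f = *-zeroˡ (f 0)

X⊗-suc : ∀ f m → (X ⊗ f) (suc m) ≡ f m
X⊗-suc f m = begin
  (X ⊗ f) (suc m)                                   ≡⟨ sumTo-head-tail m _ ⟩
  0ℚ * f (suc m) + sumTo m (λ i → X (suc i) * f (m ∸ i))
    ≡⟨ cong₂ _+_ (*-zeroˡ (f (suc m))) (sumTo-head m (λ i → *-zeroˡ (f (m ∸ suc i)))) ⟩
  0ℚ + 1ℚ * f m                                     ≡⟨ trans (+-identityˡ _) (*-identityˡ (f m)) ⟩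
  f m                                               ∎
  where open ≡-Reasoning

X⊗-⊗-zero : ∀ f g → ((X ⊗ f) ⊗ g) 0 ≡ 0ℚ
X⊗-⊗-zero f g = trans (cong (_* g 0) (X⊗-zero f)) (*-zeroˡ (g 0))

X⊗-⊗-suc : ∀ f g m → ((X ⊗ f) ⊗ g) (suc m) ≡ (f ⊗ g) m
X⊗-⊗-suc f g m = begin
  ((X ⊗ f) ⊗ g) (suc m)
    ≡⟨ sumTo-head-tail m _ ⟩
  (X ⊗ f) 0 * g (suc m) + sumTo m (λ i → (X ⊗ f) (suc i) * g (m ∸ i))
    ≡⟨ cong₂ _+_ (X⊗-⊗-zero f (λ _ → g (suc m))) (sumTo-cong m (λ i _ → cong (_* g (m ∸ i)) (X⊗-suc f i))) ⟩
  0ℚ + (f ⊗ g) m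
    ≡⟨ +-identityˡ _ ⟩
  (f ⊗ g) m ∎
  where open ≡-Reasoning

X^⊗-below : ∀ a g {m} → m ℕ.< a → ((X ^ᵖ a) ⊗ g) m ≡ 0ℚ
X^⊗-below (suc a) g {zero}  _          = X⊗-⊗-zero (X ^ᵖ a) g
X^⊗-below (suc a) g {suc m} (s≤s m<a) = trans (X⊗-⊗-suc (X ^ᵖ a) g m) (X^⊗-below a g m<a)

X^⊗-shift : ∀ a g s → ((X ^ᵖ a) ⊗ g) (a ℕ.+ s) ≡ g s
X^⊗-shift zero    g s = one⊗ g s
X^⊗-shift (suc a) g s = trans (X⊗-⊗-suc (X ^ᵖ a) g (a ℕ.+ s)) (X^⊗-shift a g s)

X+1⊗-suc : ∀ f m → (X+1 ⊗ f) (suc m) ≡ f (suc m) + f m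
X+1⊗-suc f m = trans (sumTo-head-tail m _)
  (cong₂ _+_ (*-identityˡ (f (suc m)))
             (trans (sumTo-head m (λ i → *-zeroˡ (f (m ∸ suc i)))) (*-identityˡ (f m))))

X+1^-coeff : ∀ n m → (X+1 ^ᵖ n) m ≡ ℕ→ℚ (n C m)
X+1^-coeff zero    zero    = refl
X+1^-coeff zero    (suc m) = refl
X+1^-coeff (suc n) zero    = trans (*-identityˡ _) (X+1^-coeff n 0)
X+1^-coeff (suc n) (suc m) = begin
  (X+1 ⊗ (X+1 ^ᵖ n)) (suc m)              ≡⟨ X+1⊗-suc (X+1 ^ᵖ n) m ⟩
  (X+1 ^ᵖ n) (suc m) + (X+1 ^ᵖ n) m       ≡⟨ cong₂ _+_ (X+1^-coeff n (suc m)) (X+1^-coeff n m) ⟩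
  ℕ→ℚ (n C suc m) + ℕ→ℚ (n C m)           ≡⟨ sym (ℕ→ℚ-+ (n C suc m) (n C m)) ⟩
  ℕ→ℚ (n C suc m ℕ.+ n C m)                 ≡⟨ cong ℕ→ℚ (ℕ.+-comm (n C suc m) (n C m)) ⟩
  ℕ→ℚ (n C m ℕ.+ n C suc m)                 ≡⟨ cong ℕ→ℚ (nCk+nC[k+1]≡[n+1]C[k+1] n m) ⟩
  ℕ→ℚ (suc n C suc m)                     ∎
  where open ≡-Reasoning

gen-below : ∀ d a {m} → m ℕ.< a → gen d a m ≡ 0ℚ
gen-below d a = X^⊗-below a (X+1 ^ᵖ (d ∸ a))

gen-shift : ∀ d a s → gen d a (a ℕ.+ s) ≡ ℕ→ℚ ((d ∸ a) C s)
gen-shift d a s = trans (X^⊗-shift a (X+1 ^ᵖ (d ∸ a)) s) (X+1^-coeff (d ∸ a) s)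

gen-top : ∀ {d a} → a ℕ.≤ d → gen d a d ≡ 1ℚ
gen-top {d} {a} a≤d = begin
  gen d a d                  ≡⟨ cong (gen d a) (sym (ℕ.m+[n∸m]≡n a≤d)) ⟩
  gen d a (a ℕ.+ (d ∸ a))    ≡⟨ gen-shift d a (d ∸ a) ⟩
  ℕ→ℚ ((d ∸ a) C (d ∸ a))    ≡⟨ cong ℕ→ℚ (nCn≡1 (d ∸ a)) ⟩
  1ℚ                         ∎
  where open ≡-Reasoning

binomial-sumTo : ∀ l {s N} → s ℕ.≤ N → sumTo N (λ r → ℕ→ℚ ((s C r) ℕ.* l ℕ.^ r)) ≡ ℕ→ℚ (suc l ℕ.^ s)
binomial-sumTo l {zero}  {N}     _         =
  sumTo-head N (λ r → cong (λ c → ℕ→ℚ (c ℕ.* l ℕ.^ suc r)) (k>n⇒nCk≡0 (s≤s (z≤n {r}))))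
binomial-sumTo l {suc s} {suc N} (s≤s s≤N) = begin
  sumTo (suc N) (λ r → ℕ→ℚ ((suc s C r) ℕ.* l ℕ.^ r))
    ≡⟨ sumTo-head-tail N _ ⟩
  1ℚ + sumTo N (λ r → ℕ→ℚ ((suc s C suc r) ℕ.* l ℕ.^ suc r))
    ≡⟨ cong (1ℚ +_) (trans (sumTo-cong N (λ r _ → pascal r)) (sumTo-+ N _ _)) ⟩
  1ℚ + (sumTo N (λ r → ℕ→ℚ l * ℕ→ℚ ((s C r) ℕ.* l ℕ.^ r)) + Z)
    ≡⟨ cong (λ p → 1ℚ + (p + Z)) (sumTo-*ˡ N (ℕ→ℚ l) _) ⟩
  1ℚ + (ℕ→ℚ l * B + Z)
    ≡⟨ x+[y+z]≡y+[x+z] 1ℚ (ℕ→ℚ l * B) Z ⟩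
  ℕ→ℚ l * B + (1ℚ + Z)
    ≡⟨ cong₂ (λ p q → ℕ→ℚ l * p + q) (binomial-sumTo l s≤N)
             (trans (sym (sumTo-head-tail N _)) (binomial-sumTo l (ℕ.m≤n⇒m≤1+n s≤N))) ⟩
  ℕ→ℚ l * P + P
    ≡⟨ +-comm (ℕ→ℚ l * P) P ⟩
  P + ℕ→ℚ l * P
    ≡⟨ sym (trans (ℕ→ℚ-+ (suc l ℕ.^ s) _) (cong (P +_) (ℕ→ℚ-* l (suc l ℕ.^ s)))) ⟩
  ℕ→ℚ (suc l ℕ.^ suc s) ∎
  where
  open ≡-Reasoning
  B = sumTo N (λ r → ℕ→ℚ ((s C r) ℕ.* l ℕ.^ r))
  Z = sumTo N (λ r → ℕ→ℚ ((s C suc r) ℕ.* l ℕ.^ suc r))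
  P = ℕ→ℚ (suc l ℕ.^ s)
  distrib : ∀ a b l p → (a ℕ.+ b) ℕ.* (l ℕ.* p) ≡ l ℕ.* (a ℕ.* p) ℕ.+ b ℕ.* (l ℕ.* p)
  distrib = solve-∀ℕ
  pascal : ∀ r → ℕ→ℚ ((suc s C suc r) ℕ.* l ℕ.^ suc r)
                 ≡ ℕ→ℚ l * ℕ→ℚ ((s C r) ℕ.* l ℕ.^ r) + ℕ→ℚ ((s C suc r) ℕ.* l ℕ.^ suc r)
  pascal r = begin
    ℕ→ℚ ((suc s C suc r) ℕ.* l ℕ.^ suc r)
      ≡⟨ cong (λ c → ℕ→ℚ (c ℕ.* l ℕ.^ suc r)) (sym (nCk+nC[k+1]≡[n+1]C[k+1] s r)) ⟩
    ℕ→ℚ ((s C r ℕ.+ s C suc r) ℕ.* l ℕ.^ suc r)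
      ≡⟨ cong ℕ→ℚ (distrib (s C r) (s C suc r) l (l ℕ.^ r)) ⟩
    ℕ→ℚ (l ℕ.* ((s C r) ℕ.* l ℕ.^ r) ℕ.+ (s C suc r) ℕ.* l ℕ.^ suc r)
      ≡⟨ trans (ℕ→ℚ-+ (l ℕ.* ((s C r) ℕ.* l ℕ.^ r)) _)
               (cong (_+ ℕ→ℚ ((s C suc r) ℕ.* l ℕ.^ suc r)) (ℕ→ℚ-* l ((s C r) ℕ.* l ℕ.^ r))) ⟩
    ℕ→ℚ l * ℕ→ℚ ((s C r) ℕ.* l ℕ.^ r) + ℕ→ℚ ((s C suc r) ℕ.* l ℕ.^ suc r) ∎

nCk*k!*[n∸k]!≡n! : ∀ {n k} → k ℕ.≤ n → (n C k) ℕ.* (k ! ℕ.* (n ∸ k) !) ≡ n !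
nCk*k!*[n∸k]!≡n! {n} {k} k≤n =
  trans (cong (ℕ._* (k ! ℕ.* (n ∸ k) !)) (nCk≡n!/k![n-k]! k≤n))
        (m/n*n≡m {{k ℕ.!* (n ∸ k) !≢0}} (k![n∸k]!∣n! k≤n))

-- Both sides times r! (s-r)! (n-s)! equal n! when s ≤ n; when s > n both sides vanish.
nCr*[n∸r]C[s∸r]≡nCs*sCr : ∀ {n r s} → r ℕ.≤ s → (n C r) ℕ.* ((n ∸ r) C (s ∸ r)) ≡ (n C s) ℕ.* (s C r)
nCr*[n∸r]C[s∸r]≡nCs*sCr {n} {r} {s} r≤s with s ℕ.≤? n
... | yes s≤n = ℕ.*-cancelʳ-≡ _ _ (r ! ℕ.* ((s ∸ r) ! ℕ.* (n ∸ s) !))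
                  {{ℕ.m*n≢0 _ _ {{r ℕ.!≢0}} {{(s ∸ r) ℕ.!* (n ∸ s) !≢0}}}}
                  (trans lhs (sym rhs))
  where
  open ≡-Reasoning
  regroupˡ : ∀ a x b c d → a ℕ.* x ℕ.* (b ℕ.* (c ℕ.* d)) ≡ a ℕ.* (b ℕ.* (x ℕ.* (c ℕ.* d)))
  regroupˡ = solve-∀ℕ
  regroupʳ : ∀ a x b c d → a ℕ.* x ℕ.* (b ℕ.* (c ℕ.* d)) ≡ a ℕ.* ((x ℕ.* (b ℕ.* c)) ℕ.* d)
  regroupʳ = solve-∀ℕ
  n∸r∸[s∸r]≡n∸s : (n ∸ r) ∸ (s ∸ r) ≡ n ∸ s
  n∸r∸[s∸r]≡n∸s = trans (ℕ.∸-+-assoc n r (s ∸ r)) (cong (n ∸_) (ℕ.m+[n∸m]≡n r≤s))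
  lhs : (n C r) ℕ.* ((n ∸ r) C (s ∸ r)) ℕ.* (r ! ℕ.* ((s ∸ r) ! ℕ.* (n ∸ s) !)) ≡ n !
  lhs = begin
    (n C r) ℕ.* ((n ∸ r) C (s ∸ r)) ℕ.* (r ! ℕ.* ((s ∸ r) ! ℕ.* (n ∸ s) !))
      ≡⟨ regroupˡ (n C r) ((n ∸ r) C (s ∸ r)) (r !) ((s ∸ r) !) ((n ∸ s) !) ⟩
    (n C r) ℕ.* (r ! ℕ.* (((n ∸ r) C (s ∸ r)) ℕ.* ((s ∸ r) ! ℕ.* (n ∸ s) !)))
      ≡⟨ cong (λ m → (n C r) ℕ.* (r ! ℕ.* (((n ∸ r) C (s ∸ r)) ℕ.* ((s ∸ r) ! ℕ.* m !))))
              (sym n∸r∸[s∸r]≡n∸s) ⟩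
    (n C r) ℕ.* (r ! ℕ.* (((n ∸ r) C (s ∸ r)) ℕ.* ((s ∸ r) ! ℕ.* ((n ∸ r) ∸ (s ∸ r)) !)))
      ≡⟨ cong (λ m → (n C r) ℕ.* (r ! ℕ.* m)) (nCk*k!*[n∸k]!≡n! (ℕ.∸-monoˡ-≤ r s≤n)) ⟩
    (n C r) ℕ.* (r ! ℕ.* (n ∸ r) !)
      ≡⟨ nCk*k!*[n∸k]!≡n! (ℕ.≤-trans r≤s s≤n) ⟩
    n ! ∎
  rhs : (n C s) ℕ.* (s C r) ℕ.* (r ! ℕ.* ((s ∸ r) ! ℕ.* (n ∸ s) !)) ≡ n !
  rhs = begin
    (n C s) ℕ.* (s C r) ℕ.* (r ! ℕ.* ((s ∸ r) ! ℕ.* (n ∸ s) !))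
      ≡⟨ regroupʳ (n C s) (s C r) (r !) ((s ∸ r) !) ((n ∸ s) !) ⟩
    (n C s) ℕ.* (((s C r) ℕ.* (r ! ℕ.* (s ∸ r) !)) ℕ.* (n ∸ s) !)
      ≡⟨ cong (λ m → (n C s) ℕ.* (m ℕ.* (n ∸ s) !)) (nCk*k!*[n∸k]!≡n! r≤s) ⟩
    (n C s) ℕ.* (s ! ℕ.* (n ∸ s) !)
      ≡⟨ nCk*k!*[n∸k]!≡n! s≤n ⟩
    n ! ∎
... | no s≰n = trans lhs≡0 (sym (cong (ℕ._* (s C r)) (k>n⇒nCk≡0 (ℕ.≰⇒> s≰n))))
  where
  lhs≡0 : (n C r) ℕ.* ((n ∸ r) C (s ∸ r)) ≡ 0
  lhs≡0 with r ℕ.≤? n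
  ... | yes r≤n = trans (cong ((n C r) ℕ.*_) (k>n⇒nCk≡0 (ℕ.∸-monoˡ-< (ℕ.≰⇒> s≰n) r≤n))) (ℕ.*-zeroʳ (n C r))
  ... | no r≰n  = cong (ℕ._* ((n ∸ r) C (s ∸ r))) (k>n⇒nCk≡0 (ℕ.≰⇒> r≰n))

C*gen-shift : ∀ d a r s →
  ℕ→ℚ ((d ∸ a) C r) * gen d (a ℕ.+ r) (a ℕ.+ s) ≡ ℕ→ℚ (((d ∸ a) C s) ℕ.* (s C r))
C*gen-shift d a r s with r ℕ.≤? s
... | yes r≤s = begin
  ℕ→ℚ (n C r) * gen d (a ℕ.+ r) (a ℕ.+ s)
    ≡⟨ cong (λ m → ℕ→ℚ (n C r) * gen d (a ℕ.+ r) m) a+s≡a+r+[s∸r] ⟩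
  ℕ→ℚ (n C r) * gen d (a ℕ.+ r) ((a ℕ.+ r) ℕ.+ (s ∸ r))
    ≡⟨ cong (ℕ→ℚ (n C r) *_) (gen-shift d (a ℕ.+ r) (s ∸ r)) ⟩
  ℕ→ℚ (n C r) * ℕ→ℚ ((d ∸ (a ℕ.+ r)) C (s ∸ r))
    ≡⟨ cong (λ m → ℕ→ℚ (n C r) * ℕ→ℚ (m C (s ∸ r))) (sym (ℕ.∸-+-assoc d a r)) ⟩
  ℕ→ℚ (n C r) * ℕ→ℚ ((n ∸ r) C (s ∸ r))
    ≡⟨ sym (ℕ→ℚ-* (n C r) ((n ∸ r) C (s ∸ r))) ⟩
  ℕ→ℚ ((n C r) ℕ.* ((n ∸ r) C (s ∸ r)))
    ≡⟨ cong ℕ→ℚ (nCr*[n∸r]C[s∸r]≡nCs*sCr r≤s) ⟩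
  ℕ→ℚ ((n C s) ℕ.* (s C r)) ∎
  where
  open ≡-Reasoning
  n = d ∸ a
  a+s≡a+r+[s∸r] : a ℕ.+ s ≡ (a ℕ.+ r) ℕ.+ (s ∸ r)
  a+s≡a+r+[s∸r] = sym (trans (ℕ.+-assoc a r (s ∸ r)) (cong (a ℕ.+_) (ℕ.m+[n∸m]≡n r≤s)))
... | no r≰s = trans
  (trans (cong (ℕ→ℚ ((d ∸ a) C r) *_) (gen-below d (a ℕ.+ r) (ℕ.+-monoʳ-< a (ℕ.≰⇒> r≰s))))
         (*-zeroʳ (ℕ→ℚ ((d ∸ a) C r))))
  (cong ℕ→ℚ (sym (trans (cong (((d ∸ a) C s) ℕ.*_) (k>n⇒nCk≡0 (ℕ.≰⇒> r≰s))) (ℕ.*-zeroʳ ((d ∸ a) C s)))))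

C*binomial-sumTo : ∀ l n s →
  ℕ→ℚ (n C s) * sumTo n (λ r → ℕ→ℚ ((s C r) ℕ.* l ℕ.^ r)) ≡ ℕ→ℚ (n C s) * ℕ→ℚ (suc l ℕ.^ s)
C*binomial-sumTo l n s with s ℕ.≤? n
... | yes s≤n = cong (ℕ→ℚ (n C s) *_) (binomial-sumTo l s≤n)
... | no s≰n rewrite k>n⇒nCk≡0 (ℕ.≰⇒> s≰n) =
  trans (*-zeroˡ (sumTo n (λ r → ℕ→ℚ ((s C r) ℕ.* l ℕ.^ r)))) (sym (*-zeroˡ (ℕ→ℚ (suc l ℕ.^ s))))

C*monomial*gen-shift : ∀ d a A l r s →
  ℕ→ℚ (((d ∸ a) C r) ℕ.* (A ℕ.* l ℕ.^ r)) * gen d (a ℕ.+ r) (a ℕ.+ s)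
  ≡ ℕ→ℚ A * (ℕ→ℚ ((d ∸ a) C s) * ℕ→ℚ ((s C r) ℕ.* l ℕ.^ r))
C*monomial*gen-shift d a A l r s = begin
  ℕ→ℚ ((n C r) ℕ.* (A ℕ.* l ℕ.^ r)) * g
    ≡⟨ cong (_* g) (trans (ℕ→ℚ-* (n C r) _) (cong (ℕ→ℚ (n C r) *_) (ℕ→ℚ-* A (l ℕ.^ r)))) ⟩
  (ℕ→ℚ (n C r) * (ℕ→ℚ A * ℕ→ℚ (l ℕ.^ r))) * g
    ≡⟨ x[yz]*w≡y[[xw]z] (ℕ→ℚ (n C r)) (ℕ→ℚ A) (ℕ→ℚ (l ℕ.^ r)) g ⟩
  ℕ→ℚ A * ((ℕ→ℚ (n C r) * g) * ℕ→ℚ (l ℕ.^ r))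
    ≡⟨ cong (λ p → ℕ→ℚ A * (p * ℕ→ℚ (l ℕ.^ r))) (trans (C*gen-shift d a r s) (ℕ→ℚ-* (n C s) (s C r))) ⟩
  ℕ→ℚ A * ((ℕ→ℚ (n C s) * ℕ→ℚ (s C r)) * ℕ→ℚ (l ℕ.^ r))
    ≡⟨ cong (ℕ→ℚ A *_) (*-assoc (ℕ→ℚ (n C s)) (ℕ→ℚ (s C r)) (ℕ→ℚ (l ℕ.^ r))) ⟩
  ℕ→ℚ A * (ℕ→ℚ (n C s) * (ℕ→ℚ (s C r) * ℕ→ℚ (l ℕ.^ r)))
    ≡⟨ cong (λ p → ℕ→ℚ A * (ℕ→ℚ (n C s) * p)) (sym (ℕ→ℚ-* (s C r) (l ℕ.^ r))) ⟩
  ℕ→ℚ A * (ℕ→ℚ (n C s) * ℕ→ℚ ((s C r) ℕ.* l ℕ.^ r)) ∎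
  where
  open ≡-Reasoning
  n = d ∸ a
  g = gen d (a ℕ.+ r) (a ℕ.+ s)
  x[yz]*w≡y[[xw]z] : ∀ x y z w → (x * (y * z)) * w ≡ y * ((x * w) * z)
  x[yz]*w≡y[[xw]z] = solve-∀ ℚ-ring

dilate-gen-shift : ∀ d a l s → dilate (suc l) (gen d a) (a ℕ.+ s)
  ≡ sumTo (d ∸ a) (λ r → ℕ→ℚ (((d ∸ a) C r) ℕ.* (suc l ℕ.^ a ℕ.* l ℕ.^ r)) * gen d (a ℕ.+ r) (a ℕ.+ s))
dilate-gen-shift d a l s = begin
  ℕ→ℚ (suc l ℕ.^ (a ℕ.+ s)) * gen d a (a ℕ.+ s)
    ≡⟨ cong (ℕ→ℚ (suc l ℕ.^ (a ℕ.+ s)) *_) (gen-shift d a s) ⟩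
  ℕ→ℚ (suc l ℕ.^ (a ℕ.+ s)) * ℕ→ℚ (n C s)
    ≡⟨ cong (_* ℕ→ℚ (n C s)) (trans (cong ℕ→ℚ (ℕ.^-distribˡ-+-* (suc l) a s)) (ℕ→ℚ-* A _)) ⟩
  (ℕ→ℚ A * ℕ→ℚ (suc l ℕ.^ s)) * ℕ→ℚ (n C s)
    ≡⟨ xy*z≡x*zy (ℕ→ℚ A) (ℕ→ℚ (suc l ℕ.^ s)) (ℕ→ℚ (n C s)) ⟩
  ℕ→ℚ A * (ℕ→ℚ (n C s) * ℕ→ℚ (suc l ℕ.^ s))
    ≡⟨ cong (ℕ→ℚ A *_) (sym (C*binomial-sumTo l n s)) ⟩
  ℕ→ℚ A * (ℕ→ℚ (n C s) * sumTo n binomialTerm)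
    ≡⟨ cong (ℕ→ℚ A *_) (sym (sumTo-*ˡ n (ℕ→ℚ (n C s)) binomialTerm)) ⟩
  ℕ→ℚ A * sumTo n (λ r → ℕ→ℚ (n C s) * binomialTerm r)
    ≡⟨ sym (sumTo-*ˡ n (ℕ→ℚ A) (λ r → ℕ→ℚ (n C s) * binomialTerm r)) ⟩
  sumTo n (λ r → ℕ→ℚ A * (ℕ→ℚ (n C s) * binomialTerm r))
    ≡⟨ sumTo-cong n (λ r _ → sym (C*monomial*gen-shift d a A l r s)) ⟩
  sumTo n (λ r → ℕ→ℚ ((n C r) ℕ.* (A ℕ.* l ℕ.^ r)) * gen d (a ℕ.+ r) (a ℕ.+ s)) ∎
  where
  open ≡-Reasoning
  n = d ∸ a
  A = suc l ℕ.^ a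
  binomialTerm : ℕ → ℚ
  binomialTerm r = ℕ→ℚ ((s C r) ℕ.* l ℕ.^ r)
  xy*z≡x*zy : ∀ x y z → (x * y) * z ≡ x * (z * y)
  xy*z≡x*zy = solve-∀ ℚ-ring

-- The coefficientwise form of (c x)^a (c x + 1)^(d-a) = Σ_r C(d-a,r) c^a (c-1)^r x^(a+r) (x+1)^(d-a-r)
-- for c = l + 1, which follows from c x + 1 = (x + 1) + (c - 1) x.
dilate-gen : ∀ d a l m → dilate (suc l) (gen d a) m
  ≡ sumTo (d ∸ a) (λ r → ℕ→ℚ (((d ∸ a) C r) ℕ.* (suc l ℕ.^ a ℕ.* l ℕ.^ r)) * gen d (a ℕ.+ r) m)
dilate-gen d a l m with ℕ.<-≤-connex m a
... | inj₁ m<a = trans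
  (trans (cong (ℕ→ℚ (suc l ℕ.^ m) *_) (gen-below d a m<a)) (*-zeroʳ (ℕ→ℚ (suc l ℕ.^ m))))
  (sym (sumTo-zeros (d ∸ a) (λ r _ →
    trans (cong (ℕ→ℚ (((d ∸ a) C r) ℕ.* (suc l ℕ.^ a ℕ.* l ℕ.^ r)) *_)
                (gen-below d (a ℕ.+ r) (ℕ.<-≤-trans m<a (ℕ.m≤m+n a r))))
          (*-zeroʳ (ℕ→ℚ (((d ∸ a) C r) ℕ.* (suc l ℕ.^ a ℕ.* l ℕ.^ r)))))))
... | inj₂ a≤m with ℕ.m≤n⇒∃[o]m+o≡n a≤m
...   | s , refl = dilate-gen-shift d a l s

InB-cong : ∀ {d γ f g} → (∀ m → f m ≡ g m) → InB d γ f → InB d γ g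
InB-cong f≡g (ts , adm , f≡combo) = ts , adm , λ m → trans (sym (f≡g m)) (f≡combo m)

InB-zero : ∀ {d γ} → InB d γ (λ _ → 0ℚ)
InB-zero = [] , [] , λ _ → refl

combo-++ : ∀ d ts us m → combo d (ts ++ us) m ≡ combo d ts m + combo d us m
combo-++ d []                  us m = sym (+-identityˡ (combo d us m))
combo-++ d ((i , j , c) ∷ ts) us m =
  trans (cong (c * (gen d i m + gen d j m) +_) (combo-++ d ts us m))
        (sym (+-assoc (c * (gen d i m + gen d j m)) (combo d ts m) (combo d us m)))

InB-⊕ : ∀ {d γ f g} → InB d γ f → InB d γ g → InB d γ (f ⊕ g)
InB-⊕ {d} (ts , adm , f≡) (us , adm′ , g≡) =
  ts ++ us , ++⁺ adm adm′ , λ m → trans (cong₂ _+_ (f≡ m) (g≡ m)) (sym (combo-++ d ts us m))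

InB-sumTo : ∀ {d γ} n {F : ℕ → Poly} → (∀ r → r ℕ.≤ n → InB d γ (F r)) →
            InB d γ (λ m → sumTo n (λ r → F r m))
InB-sumTo zero    F∈B = F∈B 0 z≤n
InB-sumTo (suc n) F∈B =
  InB-⊕ (InB-sumTo n (λ r r≤n → F∈B r (ℕ.m≤n⇒m≤1+n r≤n))) (F∈B (suc n) ℕ.≤-refl)

InB-pair : ∀ {d γ i j c} → Admissible d γ (i , j , c) → InB d γ (λ m → c * (gen d i m + gen d j m))
InB-pair {i = i} {j} {c} adm = (i , j , c) ∷ [] , adm ∷ [] , λ m → sym (+-identityʳ _)

sumTo-pairing : ∀ n n′ (a u b v : ℕ → ℚ) →
  sumTo n (λ r → sumTo n′ (λ r′ → (a r * b r′) * (u r + v r′)))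
  ≡ sumTo n (λ r → a r * u r) * sumTo n′ b + sumTo n a * sumTo n′ (λ r′ → b r′ * v r′)
sumTo-pairing n n′ a u b v = begin
  sumTo n (λ r → sumTo n′ (λ r′ → (a r * b r′) * (u r + v r′)))
    ≡⟨ sumTo-cong n (λ r _ → inner r) ⟩
  sumTo n (λ r → (a r * u r) * sumTo n′ b + a r * sumTo n′ (λ r′ → b r′ * v r′))
    ≡⟨ sumTo-+ n _ _ ⟩
  sumTo n (λ r → (a r * u r) * sumTo n′ b) + sumTo n (λ r → a r * sumTo n′ (λ r′ → b r′ * v r′))
    ≡⟨ cong₂ _+_ (sumTo-*ʳ n (sumTo n′ b) (λ r → a r * u r)) (sumTo-*ʳ n _ a) ⟩
  sumTo n (λ r → a r * u r) * sumTo n′ b + sumTo n a * sumTo n′ (λ r′ → b r′ * v r′) ∎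
  where
  open ≡-Reasoning
  split : ∀ a b u v → (a * b) * (u + v) ≡ (a * u) * b + a * (b * v)
  split = solve-∀ ℚ-ring
  inner : ∀ r → sumTo n′ (λ r′ → (a r * b r′) * (u r + v r′))
                ≡ (a r * u r) * sumTo n′ b + a r * sumTo n′ (λ r′ → b r′ * v r′)
  inner r = begin
    sumTo n′ (λ r′ → (a r * b r′) * (u r + v r′))
      ≡⟨ sumTo-cong n′ (λ r′ _ → split (a r) (b r′) (u r) (v r′)) ⟩
    sumTo n′ (λ r′ → (a r * u r) * b r′ + a r * (b r′ * v r′))
      ≡⟨ sumTo-+ n′ _ _ ⟩
    sumTo n′ (λ r′ → (a r * u r) * b r′) + sumTo n′ (λ r′ → a r * (b r′ * v r′))
      ≡⟨ cong₂ _+_ (sumTo-*ˡ n′ (a r * u r) b) (sumTo-*ˡ n′ (a r) (λ r′ → b r′ * v r′)) ⟩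
    (a r * u r) * sumTo n′ b + a r * sumTo n′ (λ r′ → b r′ * v r′) ∎

a+r≤d : ∀ {a d r} → a ℕ.≤ d → r ℕ.≤ d ∸ a → a ℕ.+ r ℕ.≤ d
a+r≤d {a} a≤d r≤d∸a = ℕ.≤-trans (ℕ.+-monoʳ-≤ a r≤d∸a) (ℕ.≤-reflexive (ℕ.m+[n∸m]≡n a≤d))

-- μ stands for the diagonal operator x^m ↦ μ m · x^m.
record UpwardExpansion (d : ℕ) (μ : ℕ → ℚ) : Set where
  field
    weight        : ℕ → ℕ → ℚ
    weight-nonNeg : ∀ a r → 0ℚ ≤ weight a r
    expand        : ∀ {a} → a ℕ.≤ d → ∀ m →
                    μ m * gen d a m ≡ sumTo (d ∸ a) (λ r → weight a r * gen d (a ℕ.+ r) m)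

module _ {d μ} (E : UpwardExpansion d μ) where
  open UpwardExpansion E

  -- Compare coefficients of x^d: every generator has leading coefficient 1.
  μ-top≡Σweight : ∀ {a} → a ℕ.≤ d → μ d ≡ sumTo (d ∸ a) (weight a)
  μ-top≡Σweight {a} a≤d = begin
    μ d                                                     ≡⟨ sym (*-identityʳ (μ d)) ⟩
    μ d * 1ℚ                                                ≡⟨ cong (μ d *_) (sym (gen-top a≤d)) ⟩
    μ d * gen d a d                                         ≡⟨ expand a≤d d ⟩
    sumTo (d ∸ a) (λ r → weight a r * gen d (a ℕ.+ r) d)    ≡⟨ sumTo-cong (d ∸ a) top ⟩
    sumTo (d ∸ a) (weight a)                                ∎
    where
    open ≡-Reasoning
    top : ∀ r → r ℕ.≤ d ∸ a → weight a r * gen d (a ℕ.+ r) d ≡ weight a r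
    top r r≤ = trans (cong (weight a r *_) (gen-top (a+r≤d a≤d r≤))) (*-identityʳ (weight a r))

  μ-top-nonNeg : 0ℚ ≤ μ d
  μ-top-nonNeg = subst (0ℚ ≤_) (sym (μ-top≡Σweight z≤n)) (sumTo-nonNeg d (weight-nonNeg 0))

  μ*gen≡0 : μ d ≡ 0ℚ → ∀ {a} → a ℕ.≤ d → ∀ m → μ m * gen d a m ≡ 0ℚ
  μ*gen≡0 μd≡0 {a} a≤d m = trans (expand a≤d m) (sumTo-zeros (d ∸ a) (λ r r≤ →
    trans (cong (_* gen d (a ℕ.+ r) m) (weight≡0 r≤)) (*-zeroˡ (gen d (a ℕ.+ r) m))))
    where
    weight≡0 : ∀ {r} → r ℕ.≤ d ∸ a → weight a r ≡ 0ℚ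
    weight≡0 = nonNeg-sumTo≡0 (d ∸ a) (weight-nonNeg a) (trans (sym (μ-top≡Σweight a≤d)) μd≡0)

  -- Both rows of weights sum to μ d, so the products weight i r · weight j r′ / μ d split
  -- μ · (gen i + gen j) into pairs gen (i + r) + gen (j + r′), and (i + r) + (j + r′) ≥ i + j.
  module PairSplitting (0<μd : 0ℚ ℚ.< μ d) (c : ℚ) {i j} (i≤d : i ℕ.≤ d) (j≤d : j ℕ.≤ d) where
    instance
      μd-positive : ℚ.Positive (μ d)
      μd-positive = ℚ.positive 0<μd
      μd-nonZero : ℚ.NonZero (μ d)
      μd-nonZero = pos⇒nonZero (μ d)

    pairWeight : ℕ → ℕ → ℚ
    pairWeight r r′ = (c * (1/ μ d) * weight i r) * weight j r′

    pairWeight-nonNeg : 0ℚ ≤ c → ∀ r r′ → 0ℚ ≤ pairWeight r r′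
    pairWeight-nonNeg 0≤c r r′ =
      *-nonNeg (*-nonNeg (*-nonNeg 0≤c 0≤1/μd) (weight-nonNeg i r)) (weight-nonNeg j r′)
      where
      0≤1/μd : 0ℚ ≤ 1/ μ d
      0≤1/μd = <⇒≤ (positive⁻¹ (1/ μ d) {{1/pos⇒pos (μ d)}})

    sumTo-pairWeight : ∀ m →
      sumTo (d ∸ i) (λ r → sumTo (d ∸ j) (λ r′ →
        pairWeight r r′ * (gen d (i ℕ.+ r) m + gen d (j ℕ.+ r′) m)))
      ≡ μ m * (c * (gen d i m + gen d j m))
    sumTo-pairWeight m = begin
      _ ≡⟨ sumTo-pairing (d ∸ i) (d ∸ j) (λ r → κ * weight i r) (λ r → gen d (i ℕ.+ r) m)
                                        (weight j) (λ r′ → gen d (j ℕ.+ r′) m) ⟩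
      sumTo (d ∸ i) (λ r → (κ * weight i r) * gen d (i ℕ.+ r) m) * sumTo (d ∸ j) (weight j)
        + sumTo (d ∸ i) (λ r → κ * weight i r) * Σv
        ≡⟨ cong₂ (λ x y → x * sumTo (d ∸ j) (weight j) + y * Σv)
             (trans (sumTo-cong (d ∸ i) (λ r _ → *-assoc κ (weight i r) (gen d (i ℕ.+ r) m)))
                    (sumTo-*ˡ (d ∸ i) κ (λ r → weight i r * gen d (i ℕ.+ r) m)))
             (sumTo-*ˡ (d ∸ i) κ (weight i)) ⟩
      (κ * Σu) * sumTo (d ∸ j) (weight j) + (κ * sumTo (d ∸ i) (weight i)) * Σv
        ≡⟨ cong₂ (λ x y → (κ * Σu) * x + (κ * y) * Σv) (sym (μ-top≡Σweight j≤d)) (sym (μ-top≡Σweight i≤d)) ⟩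
      (c * (1/ μ d) * Σu) * μ d + (c * (1/ μ d) * μ d) * Σv
        ≡⟨ regroup c (1/ μ d) (μ d) Σu Σv ⟩
      ((1/ μ d) * μ d) * (c * (Σu + Σv))
        ≡⟨ trans (cong (_* (c * (Σu + Σv))) (*-inverseˡ (μ d))) (*-identityˡ _) ⟩
      c * (Σu + Σv)
        ≡⟨ cong₂ (λ x y → c * (x + y)) (sym (expand i≤d m)) (sym (expand j≤d m)) ⟩
      c * (μ m * gen d i m + μ m * gen d j m)
        ≡⟨ sym (*-pair-distrib (μ m) c (gen d i m) (gen d j m)) ⟩
      μ m * (c * (gen d i m + gen d j m)) ∎
      where
      open ≡-Reasoning
      κ = c * (1/ μ d)
      Σu = sumTo (d ∸ i) (λ r → weight i r * gen d (i ℕ.+ r) m)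
      Σv = sumTo (d ∸ j) (λ r′ → weight j r′ * gen d (j ℕ.+ r′) m)
      regroup : ∀ c β M x y → (c * β * x) * M + (c * β * M) * y ≡ (β * M) * (c * (x + y))
      regroup = solve-∀ ℚ-ring

  μ*pair-InB : ∀ {γ i j c} → Admissible d γ (i , j , c) →
               InB d γ (λ m → μ m * (c * (gen d i m + gen d j m)))
  μ*pair-InB {γ} {i} {j} {c} (i≤d , j≤d , γ≤i+j , 0≤c) with <-cmp 0ℚ (μ d)
  ... | tri> _ _ μd<0 = contradiction (≤-<-trans μ-top-nonNeg μd<0) (<-irrefl refl)
  ... | tri≈ _ 0≡μd _ = InB-cong (λ m → sym (begin
    μ m * (c * (gen d i m + gen d j m))        ≡⟨ *-pair-distrib (μ m) c (gen d i m) (gen d j m) ⟩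
    c * (μ m * gen d i m + μ m * gen d j m)    ≡⟨ cong₂ (λ x y → c * (x + y)) (μ*gen≡0 (sym 0≡μd) i≤d m)
                                                                             (μ*gen≡0 (sym 0≡μd) j≤d m) ⟩
    c * (0ℚ + 0ℚ)                              ≡⟨ *-zeroʳ c ⟩
    0ℚ                                         ∎)) InB-zero
    where open ≡-Reasoning
  ... | tri< 0<μd _ _ = InB-cong sumTo-pairWeight
    (InB-sumTo (d ∸ i) λ r r≤ → InB-sumTo (d ∸ j) λ r′ r′≤ → InB-pair
      (a+r≤d i≤d r≤ , a+r≤d j≤d r′≤ ,
       ℕ.≤-trans γ≤i+j (ℕ.+-mono-≤ (ℕ.m≤m+n i r) (ℕ.m≤m+n j r′)) ,
       pairWeight-nonNeg 0≤c r r′))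
    where open PairSplitting 0<μd c i≤d j≤d

  μ*combo-InB : ∀ {γ ts} → All (Admissible d γ) ts → InB d γ (λ m → μ m * combo d ts m)
  μ*combo-InB []           = InB-cong (λ m → sym (*-zeroʳ (μ m))) InB-zero
  μ*combo-InB (adm ∷ adms) =
    InB-cong (λ m → sym (*-distribˡ-+ (μ m) _ _)) (InB-⊕ (μ*pair-InB adm) (μ*combo-InB adms))

  multiplier-preserves-InB : ∀ {γ f} → InB d γ f → InB d γ (λ m → μ m * f m)
  multiplier-preserves-InB (ts , adm , f≡combo) =
    InB-cong (λ m → cong (μ m *_) (sym (f≡combo m))) (μ*combo-InB adm)

eigenvalue-expansion : ∀ k d → UpwardExpansion d (eigenvalue k)
eigenvalue-expansion k d = record
  { weight        = weight
  ; weight-nonNeg = λ a r →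
      *-nonNeg (invFactorial-nonNeg k) (absMono-monomial ((d ∸ a) C r) a r k 0)
  ; expand        = λ {a} _ → expansion a
  }
  where
  monomial : ℕ → ℕ → ℕ → ℚ
  monomial a r l = ℕ→ℚ (((d ∸ a) C r) ℕ.* (suc l ℕ.^ a ℕ.* l ℕ.^ r))
  weight : ℕ → ℕ → ℚ
  weight a r = invFactorial k * Δ k (λ l → monomial a r l)
  expansion : ∀ a m → eigenvalue k m * gen d a m
                      ≡ sumTo (d ∸ a) (λ r → weight a r * gen d (a ℕ.+ r) m)
  expansion a m = begin
    eigenvalue k m * gen d a m
      ≡⟨ *-assoc (invFactorial k) _ (gen d a m) ⟩
    invFactorial k * (Δ k (λ l → ℕ→ℚ (suc l ℕ.^ m)) * gen d a m)
      ≡⟨ cong (invFactorial k *_) (sym (Δ-*ʳ k (gen d a m) _)) ⟩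
    invFactorial k * Δ k (λ l → dilate (suc l) (gen d a) m)
      ≡⟨ cong (invFactorial k *_) (Δ-cong k (λ l → dilate-gen d a l m)) ⟩
    invFactorial k * Δ k (λ l → sumTo (d ∸ a) (λ r → monomial a r l * gen d (a ℕ.+ r) m))
      ≡⟨ cong (invFactorial k *_) (Δ-sumTo k (d ∸ a) _) ⟩
    invFactorial k * sumTo (d ∸ a) (λ r → Δ k (λ l → monomial a r l * gen d (a ℕ.+ r) m))
      ≡⟨ cong (invFactorial k *_) (sumTo-cong (d ∸ a) (λ r _ → Δ-*ʳ k (gen d (a ℕ.+ r) m) (monomial a r))) ⟩
    invFactorial k * sumTo (d ∸ a) (λ r → Δ k (monomial a r) * gen d (a ℕ.+ r) m)
      ≡⟨ sym (sumTo-*ˡ (d ∸ a) (invFactorial k) _) ⟩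
    sumTo (d ∸ a) (λ r → invFactorial k * (Δ k (monomial a r) * gen d (a ℕ.+ r) m))
      ≡⟨ sumTo-cong (d ∸ a) (λ r _ → sym (*-assoc (invFactorial k) _ (gen d (a ℕ.+ r) m))) ⟩
    sumTo (d ∸ a) (λ r → weight a r * gen d (a ℕ.+ r) m) ∎
    where open ≡-Reasoning

lemma4p5 : (d k γ : ℕ) (f : Poly) → InB d γ f → InB d γ (φ k f)
lemma4p5 d k γ f f∈B =
  InB-cong (λ m → sym (φ-coeff k f m)) (multiplier-preserves-InB (eigenvalue-expansion k d) f∈B)
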